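{- Over any finite field $\mathbb{F}$ and for any $n\ge 2$, the determinant $\det_n$, viewed as an $n$-linear form $(\mathbb{F}^n)^n\to\mathbb{F}$ in the rows of the matrix, satisfies $\lceil\mathrm{ark}(\det_n)\rceil=2$.
   Context: For a $d$-linear form $T\colon(\mathbb{F}^n)^d\to\mathbb{F}$ over a finite field, $\mathrm{bias}(T)=\Pr[T=0]-\Pr[T=y]$ for any nonzero $y\in\mathbb{F}$ (uniform random input in $(\mathbb{F}^n)^d$), and the analytic rank is $\mathrm{ark}(T)=-\log_{|\mathbb{F}|}\mathrm{bias}(T)$. -}

module Defs where

open import Level using (0ℓ)
open import Algebra.Bundles using (CommutativeRing)
open import Data.Nat as ℕ using (ℕ; zero; suc; NonZero)
open import Data.Nat.Properties using (m^n≢0)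
open import Data.Fin using (Fin; zero; suc; toℕ; punchIn)
open import Data.List using (List; []; _∷_; length; filter; map; concatMap)
open import Data.List.Relation.Unary.Any using (Any; here; there)
open import Data.List.Relation.Unary.AllPairs using (AllPairs)
open import Data.Integer as ℤ using (ℤ; +_)
open import Data.Rational as ℚ using (ℚ; _/_)
open import Data.Product using (Σ; _×_; _,_)
open import Relation.Nullary using (¬_; Dec)
open import Relation.Binary using (Decidable)

record FiniteField : Set₁ where
  field
    commRing : CommutativeRing 0ℓ 0ℓ
  open CommutativeRing commRing public
  field
    _≟_      : Decidable _≈_
    0≉1      : ¬ (0# ≈ 1#)
    inverse  : ∀ x → ¬ (x ≈ 0#) → Σ Carrier (λ y → (x * y) ≈ 1#)
    elems    : List Carrier
    complete : ∀ x → Any (x ≈_) elems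
    distinct : AllPairs (λ a b → ¬ (a ≈ b)) elems

module _ (F : FiniteField) where
  open FiniteField F using (Carrier; _≈_; _≟_; 0#; 1#; _+_; _*_; -_; elems; complete)

  size : ℕ
  size = length elems

  instance
    size≢0 : NonZero size
    size≢0 with elems | complete 0#
    ... | _ ∷ _ | _ = _

  Input : ℕ → ℕ → Set
  Input d n = Fin d → Fin n → Carrier

  Form : ℕ → ℕ → Set
  Form d n = Input d n → Carrier

  allFuns : {A : Set} (k : ℕ) → List A → List (Fin k → A)
  allFuns zero    xs = (λ ()) ∷ []
  allFuns (suc k) xs =
    concatMap (λ a → map (λ f → λ { zero → a ; (suc i) → f i }) (allFuns k xs)) xs

  allInputs : (d n : ℕ) → List (Input d n)
  allInputs d n = allFuns d (allFuns n elems)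

  count : {d n : ℕ} → Form d n → Carrier → ℕ
  count {d} {n} T y = length (filter (λ x → T x ≟ y) (allInputs d n))

  biasAt : {d n : ℕ} → Form d n → Carrier → ℚ
  biasAt {d} {n} T y =
    ((+ count T 0#) ℤ.- (+ count T y)) / (size ℕ.^ (d ℕ.* n))
    where instance _ = m^n≢0 size (d ℕ.* n)

  -- ⌈ ark(T) ⌉ = k  where ark = −log_|F| bias, written out:
  --   k − 1 < −log_q b ≤ k   ⟺   q^{-k} ≤ b < q^{1-k} = q / q^k.
  CeilArkIs : ℚ → ℕ → Set
  CeilArkIs b k = ((+ 1 / (size ℕ.^ k)) ℚ.≤ b) × (b ℚ.< (+ size / (size ℕ.^ k)))
    where instance _ = m^n≢0 size k

  alt : ℕ → Carrier → Carrier
  alt zero    x = x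
  alt (suc k) x = - alt k x

  sumFin : (n : ℕ) → (Fin n → Carrier) → Carrier
  sumFin zero    f = 0#
  sumFin (suc n) f = f zero + sumFin n (λ i → f (suc i))

  det : (n : ℕ) → (Fin n → Fin n → Carrier) → Carrier
  det zero    M = 1#
  det (suc n) M =
    sumFin (suc n) (λ j → alt (toℕ j)
      (M zero j * det n (λ i k → M (suc i) (punchIn j k))))

  detForm : (n : ℕ) → Form n n
  detForm n = det n

{-# OPTIONS --safe #-}
module Submission where

-- Write q = |F| and N n y for the number of n × n matrices of determinant y.  Split a matrix of
-- size n + 1 into its first row r and the remaining rows.  If r = 0 the determinant vanishes.
-- Otherwise column operations, which preserve det and permute the remaining rows, move r to
-- e₀ = (1, 0, …, 0), after which det is the determinant of the lower right n × n block.  Hence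
--   N (n + 1) y = [y = 0] q^(n(n+1)) + (q^(n+1) − 1) qⁿ N n y,
-- and for y ≠ 0 the bias b n = (N n 0 − N n y) / q^(n²) satisfies b 1 = 0 and
--   b (n + 1) = q^-(n+1) + (1 − q^-(n+1)) b n.
-- So b is increasing from b 2 = q⁻², and b n + q⁻ⁿ ≤ 1/q is preserved since q ≥ 2; thus
-- q⁻² ≤ b n < q⁻¹, which says ⌈ark det_n⌉ = 2.

open import Defs
open import Level using (0ℓ)
open import Data.Nat using (ℕ; zero; suc; _≥_)
open import Data.Fin using (Fin; zero; suc)
open import Data.Product using (∃; _,_)
open import Data.Empty using (⊥-elim)
open import Function using (_∘_)
open import Relation.Nullary using (¬_; Dec; yes; no)
open import Relation.Binary using (Setoid; DecSetoid; Decidable; _Preserves_⟶_)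
open import Relation.Binary.PropositionalEquality as ≡ using (_≡_; _≢_; _≗_)

module FiniteSums where

  open import Data.Nat using (_+_; _*_; _≤_; pred; z≤n; s≤s)
  open import Data.Nat.Properties hiding (_≟_)
  open import Relation.Nullary.Decidable using (_×-dec_)
  open import Relation.Binary.PropositionalEquality using (refl; sym; trans; cong; cong₂; module ≡-Reasoning)
  open import Algebra.Properties.CommutativeSemigroup +-commutativeSemigroup using ()
    renaming (interchange to +-interchange)
  open import Function.Bundles using (Inverse)
  open import Data.List using (List; []; _∷_; length; filter; map; concatMap; _++_)
  open import Data.List.Relation.Unary.All using (All; []; _∷_)
  import Data.List.Relation.Unary.All as All
  open import Data.List.Relation.Unary.Any using (Any; here; there)
  open import Data.List.Relation.Unary.AllPairs using (AllPairs; []; _∷_)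

  ∑ : {A : Set} → List A → (A → ℕ) → ℕ
  ∑ []       f = 0
  ∑ (x ∷ xs) f = f x + ∑ xs f

  syntax ∑ L (λ x → e) = ∑[ x ∈ L ] e

  𝟙 : {P : Set} → Dec P → ℕ
  𝟙 (yes _) = 1
  𝟙 (no _)  = 0

  𝟙-⇔ : {P Q : Set} → (P → Q) → (Q → P) → (p : Dec P) (q : Dec Q) → 𝟙 p ≡ 𝟙 q
  𝟙-⇔ f g (yes _) (yes _) = refl
  𝟙-⇔ f g (yes p) (no ¬q) = ⊥-elim (¬q (f p))
  𝟙-⇔ f g (no ¬p) (yes q) = ⊥-elim (¬p (g q))
  𝟙-⇔ f g (no _)  (no _)  = refl

  𝟙-yes : {P : Set} → P → (d : Dec P) → 𝟙 d ≡ 1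
  𝟙-yes p (yes _) = refl
  𝟙-yes p (no ¬p) = ⊥-elim (¬p p)

  𝟙-no : {P : Set} → ¬ P → (d : Dec P) → 𝟙 d ≡ 0
  𝟙-no ¬p (yes p) = ⊥-elim (¬p p)
  𝟙-no ¬p (no _)  = refl

  𝟙-× : {P Q : Set} (p : Dec P) (q : Dec Q) → 𝟙 (p ×-dec q) ≡ 𝟙 p * 𝟙 q
  𝟙-× (yes _) (yes _) = refl
  𝟙-× (yes _) (no _)  = refl
  𝟙-× (no _)  _       = refl

  module _ {A : Set} where

    ∑-cong : ∀ (L : List A) {f g : A → ℕ} → (∀ x → f x ≡ g x) → ∑ L f ≡ ∑ L g
    ∑-cong []       f≗g = refl
    ∑-cong (x ∷ xs) f≗g = cong₂ _+_ (f≗g x) (∑-cong xs f≗g)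

    ∑-+ : ∀ (L : List A) (f g : A → ℕ) → ∑[ x ∈ L ] (f x + g x) ≡ ∑ L f + ∑ L g
    ∑-+ []       f g = refl
    ∑-+ (x ∷ xs) f g = trans (cong (f x + g x +_) (∑-+ xs f g)) (+-interchange (f x) (g x) _ _)

    *-distribˡ-∑ : ∀ c (L : List A) (f : A → ℕ) → c * ∑ L f ≡ ∑[ x ∈ L ] (c * f x)
    *-distribˡ-∑ c []       f = *-zeroʳ c
    *-distribˡ-∑ c (x ∷ xs) f = trans (*-distribˡ-+ c (f x) _) (cong (c * f x +_) (*-distribˡ-∑ c xs f))

    *-distribʳ-∑ : ∀ c (L : List A) (f : A → ℕ) → ∑ L f * c ≡ ∑[ x ∈ L ] (f x * c)
    *-distribʳ-∑ c L f =
      trans (*-comm (∑ L f) c) (trans (*-distribˡ-∑ c L f) (∑-cong L (λ x → *-comm c (f x))))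

    ∑-const : ∀ (L : List A) c → ∑[ x ∈ L ] c ≡ length L * c
    ∑-const []       c = refl
    ∑-const (x ∷ xs) c = cong (c +_) (∑-const xs c)

    ∑-++ : ∀ (L K : List A) (f : A → ℕ) → ∑ (L ++ K) f ≡ ∑ L f + ∑ K f
    ∑-++ []       K f = refl
    ∑-++ (x ∷ xs) K f = trans (cong (f x +_) (∑-++ xs K f)) (sym (+-assoc (f x) _ _))

    length-filter : ∀ {P : A → Set} (P? : ∀ x → Dec (P x)) (L : List A) →
                    length (filter P? L) ≡ ∑[ x ∈ L ] 𝟙 (P? x)
    length-filter P? []       = refl
    length-filter P? (x ∷ xs) with P? x
    ... | yes _ = cong suc (length-filter P? xs)
    ... | no  _ = length-filter P? xs

  module _ {A B : Set} where

    ∑-map : ∀ (g : A → B) (L : List A) (f : B → ℕ) → ∑ (map g L) f ≡ ∑[ x ∈ L ] f (g x)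
    ∑-map g []       f = refl
    ∑-map g (x ∷ xs) f = cong (f (g x) +_) (∑-map g xs f)

    ∑-concatMap : ∀ (g : A → List B) (L : List A) (f : B → ℕ) →
                  ∑ (concatMap g L) f ≡ ∑[ x ∈ L ] ∑ (g x) f
    ∑-concatMap g []       f = refl
    ∑-concatMap g (x ∷ xs) f =
      trans (∑-++ (g x) (concatMap g xs) f) (cong (∑ (g x) f +_) (∑-concatMap g xs f))

    ∑-comm : ∀ (L : List A) (K : List B) (f : A → B → ℕ) →
             ∑[ x ∈ L ] ∑[ y ∈ K ] f x y ≡ ∑[ y ∈ K ] ∑[ x ∈ L ] f x y
    ∑-comm []       K f = sym (trans (∑-const K 0) (*-zeroʳ (length K)))
    ∑-comm (x ∷ xs) K f =
      trans (cong (∑ K (f x) +_) (∑-comm xs K f)) (sym (∑-+ K (f x) (λ y → ∑[ x′ ∈ xs ] f x′ y)))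

  module _ (S : DecSetoid 0ℓ 0ℓ) where
    open DecSetoid S using (Carrier; _≈_; _≟_; setoid) renaming (sym to ≈-sym; trans to ≈-trans)

    Enumerates : List Carrier → Set
    Enumerates L = ∀ z → ∑[ x ∈ L ] 𝟙 (x ≟ z) ≡ 1

    complete∧distinct⇒enumerates : ∀ {L} → (∀ z → Any (z ≈_) L) →
      AllPairs (λ a b → ¬ a ≈ b) L → Enumerates L
    complete∧distinct⇒enumerates {L} complete distinct z = go L (complete z) distinct
      where
      absent : ∀ xs → All (λ x → ¬ x ≈ z) xs → ∑[ x ∈ xs ] 𝟙 (x ≟ z) ≡ 0
      absent []       []         = refl
      absent (x ∷ xs) (x≉z ∷ ps) with x ≟ z
      ... | yes x≈z = ⊥-elim (x≉z x≈z)
      ... | no  _   = absent xs ps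
      go : ∀ xs → Any (z ≈_) xs → AllPairs (λ a b → ¬ a ≈ b) xs → ∑[ x ∈ xs ] 𝟙 (x ≟ z) ≡ 1
      go (x ∷ xs) z∈ (x≉xs ∷ ps) with x ≟ z | z∈
      ... | yes x≈z | _        = cong suc (absent xs (All.map (λ x≉y y≈z → x≉y (≈-trans x≈z (≈-sym y≈z))) x≉xs))
      ... | no  x≉z | here z≈x = ⊥-elim (x≉z (≈-sym z≈x))
      ... | no  _   | there z∈ = go xs z∈ ps

    enumerates-suc-pred : ∀ {L} → Enumerates L → Carrier → suc (pred (length L)) ≡ length L
    enumerates-suc-pred {[]}    enum z with enum z
    ... | ()
    enumerates-suc-pred {_ ∷ _} enum z = refl

    enumerates-distinct⇒2≤length : ∀ {L x y} → Enumerates L → ¬ x ≈ y → 2 ≤ length L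
    enumerates-distinct⇒2≤length {[]}        {x} enum x≉y with enum x
    ... | ()
    enumerates-distinct⇒2≤length {a ∷ []}    {x} {y} enum x≉y with a ≟ x | a ≟ y | enum x | enum y
    ... | yes a≈x | yes a≈y | _  | _  = ⊥-elim (x≉y (≈-trans (≈-sym a≈x) a≈y))
    ... | no  _   | _       | () | _
    ... | yes _   | no  _   | _  | ()
    enumerates-distinct⇒2≤length {_ ∷ _ ∷ _} enum x≉y = s≤s (s≤s z≤n)

    module _ {L : List Carrier} (enum : Enumerates L) where

      ∑-𝟙-* : ∀ (h : Carrier → ℕ) → h Preserves _≈_ ⟶ _≡_ → ∀ z →
              ∑[ x ∈ L ] (𝟙 (x ≟ z) * h x) ≡ h z
      ∑-𝟙-* h h-cong z = begin
        ∑[ x ∈ L ] (𝟙 (x ≟ z) * h x) ≡⟨ ∑-cong L (λ x → pull x (x ≟ z)) ⟩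
        ∑[ x ∈ L ] (𝟙 (x ≟ z) * h z) ≡⟨ *-distribʳ-∑ (h z) L _ ⟨
        ∑[ x ∈ L ] 𝟙 (x ≟ z) * h z   ≡⟨ cong (_* h z) (enum z) ⟩
        1 * h z                      ≡⟨ *-identityˡ (h z) ⟩
        h z                          ∎
        where
        open ≡-Reasoning
        pull : ∀ x (d : Dec (x ≈ z)) → 𝟙 d * h x ≡ 𝟙 d * h z
        pull x (yes x≈z) = cong (1 *_) (h-cong x≈z)
        pull x (no  _)   = refl

      ∑-inverse : (ψ : Inverse setoid setoid) (h : Carrier → ℕ) → h Preserves _≈_ ⟶ _≡_ →
                  ∑[ x ∈ L ] h (Inverse.to ψ x) ≡ ∑ L h
      ∑-inverse ψ h h-cong = begin
        ∑[ x ∈ L ] h (to x)                              ≡⟨ ∑-cong L (λ x → ∑-𝟙-* h h-cong (to x)) ⟨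
        ∑[ x ∈ L ] ∑[ y ∈ L ] (𝟙 (y ≟ to x) * h y)       ≡⟨ ∑-comm L L _ ⟩
        ∑[ y ∈ L ] ∑[ x ∈ L ] (𝟙 (y ≟ to x) * h y)       ≡⟨ ∑-cong L (λ y → *-distribʳ-∑ (h y) L _) ⟨
        ∑[ y ∈ L ] (∑[ x ∈ L ] 𝟙 (y ≟ to x) * h y)       ≡⟨ ∑-cong L (λ y → cong (_* h y) (preimage y)) ⟩
        ∑[ y ∈ L ] (1 * h y)                             ≡⟨ ∑-cong L (λ y → *-identityˡ (h y)) ⟩
        ∑ L h                                            ∎
        where
        open ≡-Reasoning
        open Inverse ψ using (to; from; inverseˡ; inverseʳ)
        preimage : ∀ y → ∑[ x ∈ L ] 𝟙 (y ≟ to x) ≡ 1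
        preimage y = trans (∑-cong L λ x → 𝟙-⇔ (≈-sym ∘ inverseʳ) (≈-sym ∘ inverseˡ) (y ≟ to x) (x ≟ from y))
                           (enum (from y))

      ∑-constant-except : ∀ (g : Carrier → ℕ) → g Preserves _≈_ ⟶ _≡_ → ∀ z C →
                          (∀ x → ¬ x ≈ z → g x ≡ C) → ∑ L g ≡ g z + pred (length L) * C
      ∑-constant-except g g-cong z C g≡C = +-cancelʳ-≡ C _ _ (begin
        ∑ L g + C                                    ≡⟨ cong (∑ L g +_) (∑-𝟙-* (λ _ → C) (λ _ → refl) z) ⟨
        ∑ L g + ∑[ x ∈ L ] (𝟙 (x ≟ z) * C)           ≡⟨ ∑-+ L g _ ⟨
        ∑[ x ∈ L ] (g x + 𝟙 (x ≟ z) * C)             ≡⟨ ∑-cong L (λ x → split x (x ≟ z)) ⟩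
        ∑[ x ∈ L ] (𝟙 (x ≟ z) * g z + C)             ≡⟨ ∑-+ L _ (λ _ → C) ⟩
        ∑[ x ∈ L ] (𝟙 (x ≟ z) * g z) + ∑[ x ∈ L ] C ≡⟨ cong₂ _+_ (∑-𝟙-* (λ _ → g z) (λ _ → refl) z)
                                                                (∑-const L C) ⟩
        g z + length L * C                           ≡⟨ cong (λ n → g z + n * C)
                                                             (enumerates-suc-pred {L} enum z) ⟨
        g z + (C + pred (length L) * C)              ≡⟨ cong (g z +_) (+-comm C _) ⟩
        g z + (pred (length L) * C + C)              ≡⟨ +-assoc (g z) _ C ⟨
        g z + pred (length L) * C + C                ∎)
        where
        open ≡-Reasoning
        split : ∀ x (d : Dec (x ≈ z)) → g x + 𝟙 d * C ≡ 𝟙 d * g z + C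
        split x (yes x≈z) = cong₂ _+_ (trans (g-cong x≈z) (sym (+-identityʳ (g z)))) (+-identityʳ C)
        split x (no  x≉z) = trans (+-identityʳ (g x)) (g≡C x x≉z)

open FiniteSums

open import Data.Vec.Functional using (Vector; _∷_; tail; updateAt)
open import Data.Vec.Functional.Relation.Binary.Pointwise using (Pointwise)
import Data.Vec.Functional.Relation.Binary.Pointwise.Properties as Pointwise

module FunctionSpaces (F : FiniteField) where

  open import Data.Nat using (_+_; _*_; _^_)
  open import Data.Nat.Properties using (*-identityʳ; *-identityˡ; *-assoc; *-comm; +-identityʳ)
  open import Data.List using (List; length; map)
  open import Relation.Binary.PropositionalEquality using (refl; sym; trans; cong; module ≡-Reasoning)

  length-allFuns : ∀ {A : Set} k (L : List A) → length (allFuns F k L) ≡ length L ^ k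
  length-allFuns zero    L = refl
  length-allFuns (suc k) L = begin
    length (allFuns F (suc k) L)             ≡⟨ length≡∑1 (allFuns F (suc k) L) ⟩
    ∑[ f ∈ allFuns F (suc k) L ] 1           ≡⟨ ∑-concatMap _ L _ ⟩
    ∑[ a ∈ L ] ∑ (map _ (allFuns F k L)) _   ≡⟨ ∑-cong L (λ _ → trans (∑-map _ (allFuns F k L) _)
                                                                  (sym (length≡∑1 (allFuns F k L)))) ⟩
    ∑[ a ∈ L ] length (allFuns F k L)        ≡⟨ ∑-const L _ ⟩
    length L * length (allFuns F k L)        ≡⟨ cong (length L *_) (length-allFuns k L) ⟩
    length L * length L ^ k                  ∎
    where
    open ≡-Reasoning
    length≡∑1 : ∀ {B : Set} (K : List B) → length K ≡ ∑[ x ∈ K ] 1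
    length≡∑1 K = trans (sym (*-identityʳ (length K))) (sym (∑-const K 1))

  module _ (S : Setoid 0ℓ 0ℓ) where
    open Setoid S using (Carrier; _≈_) renaming (refl to ≈-refl)

    ∑-allFuns-suc : ∀ k (L : List Carrier) (h : Vector Carrier (suc k) → ℕ) →
                    h Preserves Pointwise _≈_ ⟶ _≡_ →
                    ∑ (allFuns F (suc k) L) h ≡ ∑[ a ∈ L ] ∑[ v ∈ allFuns F k L ] h (a ∷ v)
    ∑-allFuns-suc k L h h-cong = trans (∑-concatMap _ L h) (∑-cong L λ a →
      trans (∑-map _ (allFuns F k L) h) (∑-cong (allFuns F k L) λ v →
        h-cong λ { zero → ≈-refl ; (suc i) → ≈-refl }))

  module _ (S : DecSetoid 0ℓ 0ℓ) where
    open DecSetoid S using (Carrier; _≈_; _≟_; setoid)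

    private
      _≟ᵥ_ : ∀ {n} → Decidable (Pointwise _≈_ {n})
      _≟ᵥ_ = DecSetoid._≟_ (Pointwise.decSetoid S _)

    allFuns-enumerates : ∀ {L} → Enumerates S L → ∀ k → Enumerates (Pointwise.decSetoid S k) (allFuns F k L)
    allFuns-enumerates {L} enum zero    z = trans (+-identityʳ _) (𝟙-yes (λ ()) ((λ ()) ≟ᵥ z))
    allFuns-enumerates {L} enum (suc k) z = begin
      ∑[ f ∈ allFuns F (suc k) L ] 𝟙 (f ≟ᵥ z)
        ≡⟨ ∑-allFuns-suc setoid k L _ (λ f≈g → 𝟙-⇔ (λ f≈z i → ≈-trans (≈-sym (f≈g i)) (f≈z i))
                                                     (λ g≈z i → ≈-trans (f≈g i) (g≈z i)) _ _) ⟩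
      ∑[ a ∈ L ] ∑[ v ∈ allFuns F k L ] 𝟙 ((a ∷ v) ≟ᵥ z)
        ≡⟨ ∑-cong L (λ a → ∑-cong (allFuns F k L) (λ v → trans
             (𝟙-⇔ (λ p → p zero , p ∘ suc) (λ { (p , q) → λ { zero → p ; (suc i) → q i } }) _ _)
             (𝟙-× (a ≟ z zero) (v ≟ᵥ tail z)))) ⟩
      ∑[ a ∈ L ] ∑[ v ∈ allFuns F k L ] (𝟙 (a ≟ z zero) * 𝟙 (v ≟ᵥ tail z))
        ≡⟨ ∑-cong L (λ a → *-distribˡ-∑ (𝟙 (a ≟ z zero)) (allFuns F k L) _) ⟨
      ∑[ a ∈ L ] (𝟙 (a ≟ z zero) * ∑[ v ∈ allFuns F k L ] 𝟙 (v ≟ᵥ tail z))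
        ≡⟨ ∑-cong L (λ a → trans (cong (𝟙 (a ≟ z zero) *_) (allFuns-enumerates enum k (tail z)))
                                 (*-identityʳ _)) ⟩
      ∑[ a ∈ L ] 𝟙 (a ≟ z zero)
        ≡⟨ enum (z zero) ⟩
      1 ∎
      where
      open ≡-Reasoning
      open DecSetoid S using () renaming (sym to ≈-sym; trans to ≈-trans)

  module _ (S T : Setoid 0ℓ 0ℓ) where
    open Setoid S using () renaming (Carrier to A; _≈_ to _≈₁_)
    open Setoid T using () renaming (Carrier to B; _≈_ to _≈₂_; refl to ≈₂-refl)

    ∑-allFuns-∘ : (π : A → B) → π Preserves _≈₁_ ⟶ _≈₂_ → (L : List A) (K : List B) (c : ℕ) →
                  (∀ h → h Preserves _≈₂_ ⟶ _≡_ → ∑[ a ∈ L ] h (π a) ≡ c * ∑ K h) →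
                  ∀ k (f : Vector B k → ℕ) → f Preserves Pointwise _≈₂_ ⟶ _≡_ →
                  ∑[ x ∈ allFuns F k L ] f (π ∘ x) ≡ c ^ k * ∑ (allFuns F k K) f
    ∑-allFuns-∘ π π-cong L K c fibres zero    f f-cong =
      trans (cong (_+ 0) (f-cong (λ ()))) (sym (*-identityˡ _))
    ∑-allFuns-∘ π π-cong L K c fibres (suc k) f f-cong = begin
      ∑[ x ∈ allFuns F (suc k) L ] f (π ∘ x)
        ≡⟨ ∑-allFuns-suc S k L _ (λ x≈y → f-cong (λ i → π-cong (x≈y i))) ⟩
      ∑[ a ∈ L ] ∑[ x ∈ allFuns F k L ] f (π ∘ (a ∷ x))
        ≡⟨ ∑-cong L (λ a → ∑-cong (allFuns F k L) λ x → f-cong λ { zero → ≈₂-refl ; (suc i) → ≈₂-refl }) ⟩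
      ∑[ a ∈ L ] ∑[ x ∈ allFuns F k L ] f (π a ∷ π ∘ x)
        ≡⟨ ∑-cong L (λ a → ∑-allFuns-∘ π π-cong L K c fibres k _
                             λ y≈y′ → f-cong λ { zero → ≈₂-refl ; (suc i) → y≈y′ i }) ⟩
      ∑[ a ∈ L ] (c ^ k * ∑[ y ∈ allFuns F k K ] f (π a ∷ y))
        ≡⟨ *-distribˡ-∑ (c ^ k) L _ ⟨
      c ^ k * ∑[ a ∈ L ] ∑[ y ∈ allFuns F k K ] f (π a ∷ y)
        ≡⟨ cong (c ^ k *_) (∑-comm L (allFuns F k K) _) ⟩
      c ^ k * ∑[ y ∈ allFuns F k K ] ∑[ a ∈ L ] f (π a ∷ y)
        ≡⟨ cong (c ^ k *_) (∑-cong (allFuns F k K) λ y →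
             fibres _ λ b≈b′ → f-cong λ { zero → b≈b′ ; (suc i) → ≈₂-refl }) ⟩
      c ^ k * ∑[ y ∈ allFuns F k K ] (c * ∑[ b ∈ K ] f (b ∷ y))
        ≡⟨ cong (c ^ k *_) (*-distribˡ-∑ c (allFuns F k K) _) ⟨
      c ^ k * (c * ∑[ y ∈ allFuns F k K ] ∑[ b ∈ K ] f (b ∷ y))
        ≡⟨ cong (λ s → c ^ k * (c * s))
                (trans (∑-comm (allFuns F k K) K _) (sym (∑-allFuns-suc T k K f f-cong))) ⟩
      c ^ k * (c * ∑ (allFuns F (suc k) K) f)
        ≡⟨ *-assoc (c ^ k) c _ ⟨
      c ^ k * c * ∑ (allFuns F (suc k) K) f
        ≡⟨ cong (_* ∑ (allFuns F (suc k) K) f) (*-comm (c ^ k) c) ⟩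
      c ^ suc k * ∑ (allFuns F (suc k) K) f ∎
      where open ≡-Reasoning

module AdjacentSwap where

  open import Data.Fin using (inject₁; punchIn)

  swap : ∀ {n} → Fin n → Fin (suc n) → Fin (suc n)
  swap zero    zero          = suc zero
  swap zero    (suc zero)    = zero
  swap zero    (suc (suc c)) = suc (suc c)
  swap (suc a) zero          = zero
  swap (suc a) (suc c)       = suc (swap a c)

  swap-involutive : ∀ {n} (a : Fin n) c → swap a (swap a c) ≡ c
  swap-involutive zero    zero          = ≡.refl
  swap-involutive zero    (suc zero)    = ≡.refl
  swap-involutive zero    (suc (suc c)) = ≡.refl
  swap-involutive (suc a) zero          = ≡.refl
  swap-involutive (suc a) (suc c)       = ≡.cong suc (swap-involutive a c)

  swap-inject₁ : ∀ {n} (a : Fin n) → swap a (inject₁ a) ≡ suc a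
  swap-inject₁ zero    = ≡.refl
  swap-inject₁ (suc a) = ≡.cong suc (swap-inject₁ a)

  swap-suc : ∀ {n} (a : Fin n) → swap a (suc a) ≡ inject₁ a
  swap-suc zero    = ≡.refl
  swap-suc (suc a) = ≡.cong suc (swap-suc a)

  swap-other : ∀ {n} (a : Fin n) c → c ≢ inject₁ a → c ≢ suc a → swap a c ≡ c
  swap-other zero    zero          c≢a _    = ⊥-elim (c≢a ≡.refl)
  swap-other zero    (suc zero)    _   c≢a′ = ⊥-elim (c≢a′ ≡.refl)
  swap-other zero    (suc (suc c)) _   _    = ≡.refl
  swap-other (suc a) zero          _   _    = ≡.refl
  swap-other (suc a) (suc c)       c≢a c≢a′ = ≡.cong suc (swap-other a c (c≢a ∘ ≡.cong suc) (c≢a′ ∘ ≡.cong suc))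

  swap-punchIn-inject₁ : ∀ {n} (a : Fin n) c → swap a (punchIn (inject₁ a) c) ≡ punchIn (suc a) c
  swap-punchIn-inject₁ zero    zero    = ≡.refl
  swap-punchIn-inject₁ zero    (suc c) = ≡.refl
  swap-punchIn-inject₁ (suc a) zero    = ≡.refl
  swap-punchIn-inject₁ (suc a) (suc c) = ≡.cong suc (swap-punchIn-inject₁ a c)

  swap-punchIn : ∀ {m} (a : Fin (suc m)) i → i ≢ inject₁ a → i ≢ suc a →
                 ∃ λ a′ → ∀ c → swap a (punchIn i c) ≡ punchIn i (swap a′ c)
  swap-punchIn         zero    zero          i≢a _    = ⊥-elim (i≢a ≡.refl)
  swap-punchIn         (suc a) zero          _   _    = a , λ _ → ≡.refl
  swap-punchIn         zero    (suc zero)    _   i≢a′ = ⊥-elim (i≢a′ ≡.refl)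
  swap-punchIn {zero}  zero    (suc (suc ()))
  swap-punchIn {suc m} zero    (suc (suc i)) _   _    =
    zero , λ { zero → ≡.refl ; (suc zero) → ≡.refl ; (suc (suc c)) → ≡.refl }
  swap-punchIn {zero}  (suc ())
  swap-punchIn {suc m} (suc a) (suc i)       i≢a i≢a′
    with swap-punchIn a i (i≢a ∘ ≡.cong suc) (i≢a′ ∘ ≡.cong suc)
  ... | a′ , commute = suc a′ , λ { zero → ≡.refl ; (suc c) → ≡.cong suc (commute c) }

open AdjacentSwap

module Determinant (F : FiniteField) where
  open import Data.Nat as ℕ using (_∸_; s≤s)
  import Data.Nat.Properties as ℕ
  open import Data.Fin as Fin using (toℕ; inject₁; punchIn; punchOut)
  open import Data.Fin.Properties using (toℕ-inject₁; toℕ-injective; suc-injective; punchInᵢ≢i;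
    punchIn-punchOut; punchOut-punchIn; punchOut-cong)
  open import Relation.Binary using (tri<; tri≈; tri>)
  open import Data.Vec.Functional.Properties using (updateAt-updates; updateAt-minimal)
  open import Function.Bundles using (Inverse)
  open FiniteField F hiding (zero)
  open import Algebra.Properties.Ring ring using (-0#≈0#; -‿involutive; -‿injective; -‿+-comm; -‿distribʳ-*)
  open import Algebra.Properties.CommutativeSemigroup +-commutativeSemigroup using (interchange; x∙yz≈y∙xz)
  open import Algebra.Properties.CommutativeSemigroup *-commutativeSemigroup using ()
    renaming (x∙yz≈y∙xz to x*yz≈y*xz)
  open import Relation.Binary.Reasoning.Setoid setoid

  Matrix : ℕ → Set
  Matrix n = Fin n → Fin n → Carrier

  minor : ∀ {n} → Matrix (suc n) → Fin (suc n) → Matrix n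
  minor M j r c = M (suc r) (punchIn j c)

  -- det (suc n) M is definitionally sumFin F (suc n) (term M)
  term : ∀ {n} → Matrix (suc n) → Fin (suc n) → Carrier
  term {n} M j = alt F (toℕ j) (M zero j * det F n (minor M j))

  swapColumns : ∀ {n} → Matrix (suc n) → Fin n → Matrix (suc n)
  swapColumns M a r c = M r (swap a c)

  addColumn : ∀ {n} → Fin n → Fin n → Carrier → Vector Carrier n → Vector Carrier n
  addColumn j k l v = updateAt v j (λ x → x + l * v k)

  x+[y-x]≈y : ∀ x y → x + (y - x) ≈ y
  x+[y-x]≈y x y = trans (x∙yz≈y∙xz x y (- x)) (trans (+-congˡ (-‿inverseʳ x)) (+-identityʳ y))

  alt-cong : ∀ k {x y} → x ≈ y → alt F k x ≈ alt F k y
  alt-cong zero    x≈y = x≈y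
  alt-cong (suc k) x≈y = -‿cong (alt-cong k x≈y)

  alt-0 : ∀ k → alt F k 0# ≈ 0#
  alt-0 zero    = refl
  alt-0 (suc k) = trans (-‿cong (alt-0 k)) -0#≈0#

  alt-neg : ∀ k x → alt F k (- x) ≈ - alt F k x
  alt-neg zero    x = refl
  alt-neg (suc k) x = -‿cong (alt-neg k x)

  alt-inject₁ : ∀ {n} (a : Fin n) x → alt F (toℕ (inject₁ a)) x ≡ alt F (toℕ a) x
  alt-inject₁ a x = ≡.cong (λ k → alt F k x) (toℕ-inject₁ a)

  alt-linear : ∀ k x l y → alt F k (x + l * y) ≈ alt F k x + l * alt F k y
  alt-linear zero    x l y = refl
  alt-linear (suc k) x l y = begin
    - alt F k (x + l * y)              ≈⟨ -‿cong (alt-linear k x l y) ⟩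
    - (alt F k x + l * alt F k y)      ≈⟨ -‿+-comm _ _ ⟨
    - alt F k x + - (l * alt F k y)    ≈⟨ +-congˡ (-‿distribʳ-* l _) ⟩
    - alt F k x + l * - alt F k y      ∎

  sumFin-cong : ∀ n {f g : Fin n → Carrier} → (∀ i → f i ≈ g i) → sumFin F n f ≈ sumFin F n g
  sumFin-cong zero    f≈g = refl
  sumFin-cong (suc n) f≈g = +-cong (f≈g zero) (sumFin-cong n (f≈g ∘ suc))

  sumFin-zero : ∀ n (f : Fin n → Carrier) → (∀ i → f i ≈ 0#) → sumFin F n f ≈ 0#
  sumFin-zero zero    f f≈0 = refl
  sumFin-zero (suc n) f f≈0 = trans (+-cong (f≈0 zero) (sumFin-zero n (f ∘ suc) (f≈0 ∘ suc))) (+-identityʳ 0#)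

  sumFin-linear : ∀ n l (f g h : Fin n → Carrier) → (∀ i → f i ≈ g i + l * h i) →
                  sumFin F n f ≈ sumFin F n g + l * sumFin F n h
  sumFin-linear zero    l f g h _   = sym (trans (+-congˡ (zeroʳ l)) (+-identityʳ 0#))
  sumFin-linear (suc n) l f g h f≈ = begin
    f zero + sumFin F n (f ∘ suc)
      ≈⟨ +-cong (f≈ zero) (sumFin-linear n l (f ∘ suc) (g ∘ suc) (h ∘ suc) (f≈ ∘ suc)) ⟩
    (g zero + l * h zero) + (sumFin F n (g ∘ suc) + l * sumFin F n (h ∘ suc))
      ≈⟨ interchange _ _ _ _ ⟩
    (g zero + sumFin F n (g ∘ suc)) + (l * h zero + l * sumFin F n (h ∘ suc))
      ≈⟨ +-congˡ (distribˡ l _ _) ⟨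
    (g zero + sumFin F n (g ∘ suc)) + l * (h zero + sumFin F n (h ∘ suc)) ∎

  sumFin-neg : ∀ n (f : Fin n → Carrier) → sumFin F n (λ i → - f i) ≈ - sumFin F n f
  sumFin-neg zero    f = sym -0#≈0#
  sumFin-neg (suc n) f = trans (+-congˡ (sumFin-neg n (f ∘ suc))) (-‿+-comm _ _)

  sumFin-swap : ∀ {n} (a : Fin n) (f : Fin (suc n) → Carrier) →
                sumFin F (suc n) (f ∘ swap a) ≈ sumFin F (suc n) f
  sumFin-swap zero    f = x∙yz≈y∙xz _ _ _
  sumFin-swap (suc a) f = +-congˡ (sumFin-swap a (f ∘ suc))

  sumFin-pair : ∀ {n} (a : Fin n) (f : Fin (suc n) → Carrier) →
                (∀ i → i ≢ inject₁ a → i ≢ suc a → f i ≈ 0#) →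
                sumFin F (suc n) f ≈ f (inject₁ a) + f (suc a)
  sumFin-pair {suc n} zero    f f≈0 =
    +-congˡ (trans (+-congˡ (sumFin-zero n _ λ i → f≈0 (suc (suc i)) (λ ()) (λ ()))) (+-identityʳ _))
  sumFin-pair         (suc a) f f≈0 =
    trans (+-cong (f≈0 zero (λ ()) (λ ())) (sumFin-pair a (f ∘ suc) λ i i≢a i≢a′ →
                   f≈0 (suc i) (i≢a ∘ suc-injective) (i≢a′ ∘ suc-injective)))
          (+-identityˡ _)

  det-cong : ∀ n {M N : Matrix n} → (∀ r c → M r c ≈ N r c) → det F n M ≈ det F n N
  term-cong : ∀ {n} {M N : Matrix (suc n)} → (∀ r c → M r c ≈ N r c) → ∀ j → term M j ≈ term N j

  det-cong zero    M≈N = refl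
  det-cong (suc n) M≈N = sumFin-cong (suc n) (term-cong M≈N)

  term-cong {n} M≈N j =
    alt-cong (toℕ j) (*-cong (M≈N zero j) (det-cong n (λ r c → M≈N (suc r) (punchIn j c))))

  det-1 : ∀ (M : Matrix 1) → det F 1 M ≈ M zero zero
  det-1 M = trans (+-identityʳ _) (*-identityʳ _)

  zero-row⇒det≈0 : ∀ m (M : Matrix (suc m)) → (∀ c → M zero c ≈ 0#) → det F (suc m) M ≈ 0#
  zero-row⇒det≈0 m M row≈0 = sumFin-zero (suc m) (term M) λ i →
    trans (alt-cong (toℕ i) (trans (*-congʳ (row≈0 i)) (zeroˡ _))) (alt-0 (toℕ i))

  det-unit-row : ∀ m (M : Matrix (suc m)) → M zero zero ≈ 1# → (∀ c → M zero (suc c) ≈ 0#) →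
                 det F (suc m) M ≈ det F m (λ r c → M (suc r) (suc c))
  det-unit-row m M M₀₀≈1 row≈0 = begin
    M zero zero * det F m (λ r c → M (suc r) (suc c)) + sumFin F m (term M ∘ suc)
      ≈⟨ +-cong (trans (*-congʳ M₀₀≈1) (*-identityˡ _)) (sumFin-zero m _ λ i →
           trans (alt-cong (suc (toℕ i)) (trans (*-congʳ (row≈0 i)) (zeroˡ _))) (alt-0 (suc (toℕ i)))) ⟩
    det F m (λ r c → M (suc r) (suc c)) + 0#
      ≈⟨ +-identityʳ _ ⟩
    det F m (λ r c → M (suc r) (suc c)) ∎

  det-linear : ∀ n (j : Fin n) l {M M₁ M₂ : Matrix n} →
    (∀ r c → c ≢ j → M r c ≈ M₁ r c) → (∀ r c → c ≢ j → M r c ≈ M₂ r c) →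
    (∀ r → M r j ≈ M₁ r j + l * M₂ r j) → det F n M ≈ det F n M₁ + l * det F n M₂
  det-linear (suc n) j l {M} {M₁} {M₂} M≈M₁ M≈M₂ Mj≈ = sumFin-linear (suc n) l _ _ _ linear-term
    where
    linear-product : ∀ i → M zero i * det F n (minor M i) ≈
                           M₁ zero i * det F n (minor M₁ i) + l * (M₂ zero i * det F n (minor M₂ i))
    linear-product i with i Fin.≟ j
    ... | yes ≡.refl = begin
      M zero i * D                                  ≈⟨ *-congʳ (Mj≈ zero) ⟩
      (M₁ zero i + l * M₂ zero i) * D               ≈⟨ distribʳ _ _ _ ⟩
      M₁ zero i * D + (l * M₂ zero i) * D           ≈⟨ +-cong (*-congˡ (same-minor M≈M₁))
                                                              (trans (*-assoc _ _ _)
                                                                     (*-congˡ (*-congˡ (same-minor M≈M₂)))) ⟩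
      M₁ zero i * det F n (minor M₁ i) + l * (M₂ zero i * det F n (minor M₂ i)) ∎
      where
      D = det F n (minor M i)
      same-minor : ∀ {N} → (∀ r c → c ≢ i → M r c ≈ N r c) → D ≈ det F n (minor N i)
      same-minor M≈N = det-cong n λ r c → M≈N (suc r) (punchIn i c) (punchInᵢ≢i i c)
    ... | no i≢j = begin
      M zero i * det F n (minor M i)
        ≈⟨ *-congˡ (det-linear n (punchOut i≢j) l
             (λ r c c≢j′ → M≈M₁ (suc r) (punchIn i c) (away c c≢j′))
             (λ r c c≢j′ → M≈M₂ (suc r) (punchIn i c) (away c c≢j′))
             (λ r → ≡.subst (λ x → M (suc r) x ≈ M₁ (suc r) x + l * M₂ (suc r) x)
                            (≡.sym (punchIn-punchOut i≢j)) (Mj≈ (suc r)))) ⟩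
      M zero i * (det F n (minor M₁ i) + l * det F n (minor M₂ i))
        ≈⟨ trans (distribˡ _ _ _) (+-congˡ (x*yz≈y*xz _ _ _)) ⟩
      M zero i * det F n (minor M₁ i) + l * (M zero i * det F n (minor M₂ i))
        ≈⟨ +-cong (*-congʳ (M≈M₁ zero i i≢j)) (*-congˡ (*-congʳ (M≈M₂ zero i i≢j))) ⟩
      M₁ zero i * det F n (minor M₁ i) + l * (M₂ zero i * det F n (minor M₂ i)) ∎
      where
      away : ∀ c → c ≢ punchOut i≢j → punchIn i c ≢ j
      away c c≢j′ ≡j = c≢j′ (≡.trans (≡.sym (punchOut-punchIn i)) (punchOut-cong i ≡j))

    linear-term : ∀ i → term M i ≈ term M₁ i + l * term M₂ i
    linear-term i = trans (alt-cong (toℕ i) (linear-product i)) (alt-linear (toℕ i) _ l _)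

  term-swap-inject₁ : ∀ {n} (a : Fin n) (M : Matrix (suc n)) →
                      term (swapColumns M a) (inject₁ a) ≈ - term M (suc a)
  term-swap-inject₁ {n} a M = begin
    alt F (toℕ (inject₁ a)) (M zero (swap a (inject₁ a)) * det F n (minor (swapColumns M a) (inject₁ a)))
      ≡⟨ alt-inject₁ a _ ⟩
    alt F (toℕ a) (M zero (swap a (inject₁ a)) * det F n (minor (swapColumns M a) (inject₁ a)))
      ≈⟨ alt-cong (toℕ a) (*-cong (reflexive (≡.cong (M zero) (swap-inject₁ a)))
                                  (det-cong n λ r c →
                                     reflexive (≡.cong (M (suc r)) (swap-punchIn-inject₁ a c)))) ⟩
    alt F (toℕ a) (M zero (suc a) * det F n (minor M (suc a)))
      ≈⟨ -‿involutive _ ⟨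
    - term M (suc a) ∎

  term-swap-suc : ∀ {n} (a : Fin n) (M : Matrix (suc n)) →
                  term (swapColumns M a) (suc a) ≈ - term M (inject₁ a)
  term-swap-suc {n} a M = -‿cong (begin
    alt F (toℕ a) (M zero (swap a (suc a)) * det F n (minor (swapColumns M a) (suc a)))
      ≈⟨ alt-cong (toℕ a) (*-cong (reflexive (≡.cong (M zero) (swap-suc a)))
                                  (det-cong n λ r c → reflexive (≡.cong (M (suc r)) (unswap c)))) ⟩
    alt F (toℕ a) (M zero (inject₁ a) * det F n (minor M (inject₁ a)))
      ≡⟨ alt-inject₁ a _ ⟨
    term M (inject₁ a) ∎)
    where
    unswap : ∀ c → swap a (punchIn (suc a) c) ≡ punchIn (inject₁ a) c
    unswap c = ≡.trans (≡.cong (swap a) (≡.sym (swap-punchIn-inject₁ a c))) (swap-involutive a _)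

  det-swapColumns : ∀ n (a : Fin n) (M : Matrix (suc n)) → det F (suc n) (swapColumns M a) ≈ - det F (suc n) M
  det-swapColumns (suc m) a M = begin
    sumFin F (suc (suc m)) (term (swapColumns M a))    ≈⟨ sumFin-cong (suc (suc m)) swapped-term ⟩
    sumFin F (suc (suc m)) (λ i → - term M (swap a i)) ≈⟨ sumFin-neg (suc (suc m)) (term M ∘ swap a) ⟩
    - sumFin F (suc (suc m)) (term M ∘ swap a)         ≈⟨ -‿cong (sumFin-swap a (term M)) ⟩
    - sumFin F (suc (suc m)) (term M)                  ∎
    where
    swapped-term : ∀ i → term (swapColumns M a) i ≈ - term M (swap a i)
    swapped-term i with i Fin.≟ inject₁ a | i Fin.≟ suc a
    ... | yes ≡.refl | _          =
      trans (term-swap-inject₁ a M) (reflexive (≡.cong (-_ ∘ term M) (≡.sym (swap-inject₁ a))))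
    ... | no _       | yes ≡.refl =
      trans (term-swap-suc a M) (reflexive (≡.cong (-_ ∘ term M) (≡.sym (swap-suc a))))
    ... | no i≢a     | no i≢a′ with swap-punchIn a i i≢a i≢a′
    ...   | a′ , commute = begin
      alt F (toℕ i) (M zero (swap a i) * det F (suc m) (minor (swapColumns M a) i))
        ≈⟨ alt-cong (toℕ i) (*-cong (reflexive (≡.cong (M zero) (swap-other a i i≢a i≢a′)))
                                    (det-cong (suc m) λ r c → reflexive (≡.cong (M (suc r)) (commute c)))) ⟩
      alt F (toℕ i) (M zero i * det F (suc m) (swapColumns (minor M i) a′))
        ≈⟨ alt-cong (toℕ i) (*-congˡ (det-swapColumns m a′ (minor M i))) ⟩
      alt F (toℕ i) (M zero i * - det F (suc m) (minor M i))
        ≈⟨ alt-cong (toℕ i) (-‿distribʳ-* _ _) ⟨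
      alt F (toℕ i) (- (M zero i * det F (suc m) (minor M i)))
        ≈⟨ alt-neg (toℕ i) _ ⟩
      - term M i
        ≡⟨ ≡.cong (-_ ∘ term M) (swap-other a i i≢a i≢a′) ⟨
      - term M (swap a i) ∎

  swap-invariant⇒det≈0 : ∀ n (a : Fin n) (M : Matrix (suc n)) →
                       (∀ r c → M r (swap a c) ≈ M r c) → det F (suc n) M ≈ 0#
  swap-invariant⇒det≈0 (suc m) a M invariant = begin
    sumFin F (suc (suc m)) (term M)           ≈⟨ sumFin-pair a (term M) vanishing ⟩
    term M (inject₁ a) + term M (suc a)       ≈⟨ +-congˡ (trans (term-cong (λ r c → sym (invariant r c)) (suc a))
                                                                (term-swap-suc a M)) ⟩
    term M (inject₁ a) + - term M (inject₁ a) ≈⟨ -‿inverseʳ _ ⟩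
    0#                                        ∎
    where
    vanishing : ∀ i → i ≢ inject₁ a → i ≢ suc a → term M i ≈ 0#
    vanishing i i≢a i≢a′ with swap-punchIn a i i≢a i≢a′
    ... | a′ , commute = trans (alt-cong (toℕ i) (trans (*-congˡ minor≈0) (zeroʳ _))) (alt-0 (toℕ i))
      where
      minor≈0 : det F (suc m) (minor M i) ≈ 0#
      minor≈0 = swap-invariant⇒det≈0 m a′ (minor M i) λ r c →
        trans (reflexive (≡.cong (M (suc r)) (≡.sym (commute c)))) (invariant (suc r) (punchIn i c))

  adjacent-equal⇒swap-invariant : ∀ {n} (a : Fin n) (M : Matrix (suc n)) →
    (∀ r → M r (inject₁ a) ≈ M r (suc a)) → ∀ r c → M r (swap a c) ≈ M r c
  adjacent-equal⇒swap-invariant a M equal r c with c Fin.≟ inject₁ a | c Fin.≟ suc a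
  ... | yes ≡.refl | _          = trans (reflexive (≡.cong (M r) (swap-inject₁ a))) (sym (equal r))
  ... | no _       | yes ≡.refl = trans (reflexive (≡.cong (M r) (swap-suc a))) (equal r)
  ... | no c≢a     | no c≢a′    = reflexive (≡.cong (M r) (swap-other a c c≢a c≢a′))

  -- swapping column suc c with its left neighbour brings the copy of column a one step closer
  equal-columns-at-distance⇒det≈0 : ∀ d {n} (M : Matrix (suc n)) a (c : Fin n) →
    toℕ c ≡ toℕ a ℕ.+ d → (∀ r → M r a ≈ M r (suc c)) → det F (suc n) M ≈ 0#
  equal-columns-at-distance⇒det≈0 zero {n} M a c c≡a equal =
    swap-invariant⇒det≈0 n c M (adjacent-equal⇒swap-invariant c M equal′)
    where
    a≡c : a ≡ inject₁ c
    a≡c = toℕ-injective (≡.sym (≡.trans (toℕ-inject₁ c) (≡.trans c≡a (ℕ.+-identityʳ (toℕ a)))))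
    equal′ : ∀ r → M r (inject₁ c) ≈ M r (suc c)
    equal′ r = ≡.subst (λ x → M r x ≈ M r (suc c)) a≡c (equal r)
  equal-columns-at-distance⇒det≈0 (suc d) M a zero    c≡a equal =
    ⊥-elim (ℕ.0≢1+n (≡.trans c≡a (ℕ.+-suc (toℕ a) d)))
  equal-columns-at-distance⇒det≈0 (suc d) {n} M a (suc c) c≡a equal =
    -‿injective (trans (trans (sym (det-swapColumns n (suc c) M)) swapped≈0) (sym -0#≈0#))
    where
    a<c : toℕ a ℕ.< toℕ (suc c)
    a<c = ≡.subst (toℕ a ℕ.<_) (≡.sym c≡a) (ℕ.m<m+n (toℕ a) (s≤s ℕ.z≤n))
    a≢c : a ≢ inject₁ (suc c)
    a≢c a≡c = ℕ.<⇒≢ a<c (≡.trans (≡.cong toℕ a≡c) (toℕ-inject₁ (suc c)))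
    a≢c′ : a ≢ suc (suc c)
    a≢c′ a≡c′ = ℕ.<⇒≢ (ℕ.m<n⇒m<1+n a<c) (≡.cong toℕ a≡c′)
    swapped≈0 : det F (suc n) (swapColumns M (suc c)) ≈ 0#
    swapped≈0 = equal-columns-at-distance⇒det≈0 d (swapColumns M (suc c)) a (inject₁ c)
      (≡.trans (toℕ-inject₁ c) (ℕ.suc-injective (≡.trans c≡a (ℕ.+-suc (toℕ a) d)))) λ r → begin
        M r (swap (suc c) a)                 ≡⟨ ≡.cong (M r) (swap-other (suc c) a a≢c a≢c′) ⟩
        M r a                                ≈⟨ equal r ⟩
        M r (suc (suc c))                    ≡⟨ ≡.cong (M r) (swap-inject₁ (suc c)) ⟨
        M r (swap (suc c) (inject₁ (suc c))) ∎

  equal-columns-ordered⇒det≈0 : ∀ {n} (M : Matrix n) {a b} → toℕ a ℕ.< toℕ b →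
                                (∀ r → M r a ≈ M r b) → det F n M ≈ 0#
  equal-columns-ordered⇒det≈0 {suc n} M {a} {suc c} (s≤s a≤c) =
    equal-columns-at-distance⇒det≈0 (toℕ c ∸ toℕ a) M a c (≡.sym (ℕ.m+[n∸m]≡n a≤c))

  equal-columns⇒det≈0 : ∀ {n} (M : Matrix n) {a b} → a ≢ b → (∀ r → M r a ≈ M r b) → det F n M ≈ 0#
  equal-columns⇒det≈0 M {a} {b} a≢b equal with ℕ.<-cmp (toℕ a) (toℕ b)
  ... | tri< a<b _ _ = equal-columns-ordered⇒det≈0 M a<b equal
  ... | tri≈ _ a≡b _ = ⊥-elim (a≢b (toℕ-injective a≡b))
  ... | tri> _ _ b<a = equal-columns-ordered⇒det≈0 M b<a (sym ∘ equal)

  addColumn-cong : ∀ {n} (j k : Fin n) l {v w : Vector Carrier n} → (∀ c → v c ≈ w c) →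
                   ∀ c → addColumn j k l v c ≈ addColumn j k l w c
  addColumn-cong j k l {v} {w} v≈w c with c Fin.≟ j
  ... | yes ≡.refl = begin
    addColumn c k l v c ≡⟨ updateAt-updates c v ⟩
    v c + l * v k       ≈⟨ +-cong (v≈w c) (*-congˡ (v≈w k)) ⟩
    w c + l * w k       ≡⟨ updateAt-updates c w ⟨
    addColumn c k l w c ∎
  ... | no c≢j = begin
    addColumn j k l v c ≡⟨ updateAt-minimal c j v c≢j ⟩
    v c                 ≈⟨ v≈w c ⟩
    w c                 ≡⟨ updateAt-minimal c j w c≢j ⟨
    addColumn j k l w c ∎

  addColumn-cancel : ∀ {n} {j k : Fin n} → j ≢ k → ∀ {l l′} → l + l′ ≈ 0# →
                     ∀ v c → addColumn j k l′ (addColumn j k l v) c ≈ v c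
  addColumn-cancel {j = j} {k} j≢k {l} {l′} l+l′≈0 v c with c Fin.≟ j
  ... | yes ≡.refl = begin
    addColumn c k l′ (addColumn c k l v) c                    ≡⟨ updateAt-updates c (addColumn c k l v) ⟩
    addColumn c k l v c + l′ * addColumn c k l v k            ≡⟨ ≡.cong₂ (λ x y → x + l′ * y)
                                                                         (updateAt-updates c v)
                                                                         (updateAt-minimal k c v (j≢k ∘ ≡.sym)) ⟩
    (v c + l * v k) + l′ * v k                                ≈⟨ +-assoc _ _ _ ⟩
    v c + (l * v k + l′ * v k)                                ≈⟨ +-congˡ (distribʳ _ _ _) ⟨
    v c + (l + l′) * v k                                      ≈⟨ +-congˡ (trans (*-congʳ l+l′≈0) (zeroˡ _)) ⟩
    v c + 0#                                                  ≈⟨ +-identityʳ _ ⟩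
    v c                                                       ∎
  ... | no c≢j = reflexive (≡.trans (updateAt-minimal c j _ c≢j) (updateAt-minimal c j v c≢j))

  addColumn-inverse : ∀ {m n} {j k : Fin n} → j ≢ k → Carrier →
    Inverse (Pointwise.setoid (Pointwise.setoid setoid n) m) (Pointwise.setoid (Pointwise.setoid setoid n) m)
  addColumn-inverse {j = j} {k} j≢k l = record
    { to        = λ R i → addColumn j k l (R i)
    ; from      = λ R i → addColumn j k (- l) (R i)
    ; to-cong   = λ R≈S i → addColumn-cong j k l (R≈S i)
    ; from-cong = λ R≈S i → addColumn-cong j k (- l) (R≈S i)
    ; inverse   = (λ {R} S≈ i c → trans (addColumn-cong j k l (S≈ i) c)
                                          (addColumn-cancel j≢k (-‿inverseˡ l) (R i) c))
                , (λ {R} S≈ i c → trans (addColumn-cong j k (- l) (S≈ i) c)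
                                          (addColumn-cancel j≢k (-‿inverseʳ l) (R i) c))
    }

  det-addColumn : ∀ n (M : Matrix n) {j k} → j ≢ k → ∀ l → det F n (λ r → addColumn j k l (M r)) ≈ det F n M
  det-addColumn n M {j} {k} j≢k l = begin
    det F n (λ r → addColumn j k l (M r)) ≈⟨ det-linear n j l (λ r c → off r c)
                                               (λ r c c≢j → trans (off r c c≢j) (sym (off r c c≢j))) at-j ⟩
    det F n M + l * det F n Mₖ            ≈⟨ +-congˡ (trans (*-congˡ Mₖ≈0) (zeroʳ l)) ⟩
    det F n M + 0#                        ≈⟨ +-identityʳ _ ⟩
    det F n M                             ∎
    where
    Mₖ : Matrix n
    Mₖ r = updateAt (M r) j (λ _ → M r k)
    off : ∀ r {f} c → c ≢ j → updateAt (M r) j f c ≈ M r c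
    off r c c≢j = reflexive (updateAt-minimal c j (M r) c≢j)
    at-j : ∀ r → addColumn j k l (M r) j ≈ M r j + l * Mₖ r j
    at-j r = reflexive (≡.trans (updateAt-updates j (M r))
                                (≡.cong (λ x → M r j + l * x) (≡.sym (updateAt-updates j (M r)))))
    Mₖ≈0 : det F n Mₖ ≈ 0#
    Mₖ≈0 = equal-columns⇒det≈0 Mₖ j≢k λ r →
      reflexive (≡.trans (updateAt-updates j (M r)) (≡.sym (updateAt-minimal k j (M r) (j≢k ∘ ≡.sym))))

  addColumn-to-one : ∀ {n} (j k : Fin n) (v : Vector Carrier n) → ¬ v k ≈ 0# →
                     ∃ λ l → addColumn j k l v j ≈ 1#
  addColumn-to-one j k v vₖ≉0 with inverse (v k) vₖ≉0
  ... | z , vₖz≈1 = (1# - v j) * z , (begin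
    addColumn j k ((1# - v j) * z) v j ≡⟨ updateAt-updates j v ⟩
    v j + (1# - v j) * z * v k         ≈⟨ +-congˡ (trans (*-assoc _ _ _)
                                                         (*-congˡ (trans (*-comm z (v k)) vₖz≈1))) ⟩
    v j + (1# - v j) * 1#              ≈⟨ +-congˡ (*-identityʳ _) ⟩
    v j + (1# - v j)                   ≈⟨ x+[y-x]≈y (v j) 1# ⟩
    1#                                 ∎)

  addColumn-update : ∀ {n} (t : Vector Carrier n) i a c →
                     addColumn (suc i) zero (a - t i) (1# ∷ t) c ≈ (1# ∷ updateAt t i (λ _ → a)) c
  addColumn-update t i a zero    = refl
  addColumn-update t i a (suc c) with c Fin.≟ i
  ... | yes ≡.refl = begin
    updateAt t c (λ x → x + (a - t c) * 1#) c ≡⟨ updateAt-updates c t ⟩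
    t c + (a - t c) * 1#                      ≈⟨ +-congˡ (*-identityʳ _) ⟩
    t c + (a - t c)                           ≈⟨ x+[y-x]≈y (t c) a ⟩
    a                                         ≡⟨ updateAt-updates c t ⟨
    updateAt t c (λ _ → a) c                  ∎
  ... | no c≢i = reflexive (≡.trans (updateAt-minimal c i t c≢i) (≡.sym (updateAt-minimal c i t c≢i)))

open import Data.Nat using (_+_; _*_; _^_; _∸_; _≤_; _<_; pred; NonZero; >-nonZero; z≤n; s≤s)
open import Data.Nat.Properties hiding (_≟_)
open import Data.Nat.Tactic.RingSolver using (solve-∀)
open ≡ using (refl; sym; trans; cong; cong₂; module ≡-Reasoning)

update-invariant⇒constant : ∀ {A : Set} m (f : Vector A m → ℕ) → f Preserves _≗_ ⟶ _≡_ →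
                            (∀ v i a → f (updateAt v i (λ _ → a)) ≡ f v) → ∀ v w → f v ≡ f w
update-invariant⇒constant zero    f f-cong invariant v w = f-cong (λ ())
update-invariant⇒constant (suc m) f f-cong invariant v w = begin
  f v                                ≡⟨ invariant v zero (w zero) ⟨
  f (updateAt v zero (λ _ → w zero)) ≡⟨ f-cong (λ { zero → refl ; (suc i) → refl }) ⟩
  f (w zero ∷ tail v)                ≡⟨ update-invariant⇒constant m (λ t → f (w zero ∷ t))
                                          (λ t≗t′ → f-cong λ { zero → refl ; (suc i) → t≗t′ i })
                                          (λ t i a → trans (f-cong λ { zero → refl ; (suc j) → refl })
                                                           (invariant (w zero ∷ t) (suc i) a))
                                          (tail v) (tail w) ⟩
  f (w zero ∷ tail w)                ≡⟨ f-cong (λ { zero → refl ; (suc i) → refl }) ⟩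
  f w                                ∎
  where open ≡-Reasoning

module Counting (F : FiniteField) where
  open FiniteField F using (Carrier; _≈_; _≟_; 0#; 1#; 0≉1; elems; complete; distinct; isEquivalence; setoid)
    renaming (refl to ≈-refl; sym to ≈-sym; trans to ≈-trans; reflexive to ≈-reflexive)
  open Determinant F using (det-cong; zero-row⇒det≈0; det-unit-row; det-1; det-addColumn; addColumn;
    addColumn-inverse; addColumn-to-one; addColumn-update)
  open FunctionSpaces F
  open import Data.List using (List; length)
  open import Data.Fin.Properties using (¬∀⟶∃¬)

  q : ℕ
  q = size F

  field-decSetoid : DecSetoid 0ℓ 0ℓ
  field-decSetoid = record { isDecEquivalence = record { isEquivalence = isEquivalence ; _≟_ = _≟_ } }

  row-decSetoid : ℕ → DecSetoid 0ℓ 0ℓ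
  row-decSetoid = Pointwise.decSetoid field-decSetoid

  matrix-decSetoid : ℕ → ℕ → DecSetoid 0ℓ 0ℓ
  matrix-decSetoid m n = Pointwise.decSetoid (row-decSetoid n) m

  rows : ∀ n → List (Vector Carrier n)
  rows n = allFuns F n elems

  elems-enumerates : Enumerates field-decSetoid elems
  elems-enumerates = complete∧distinct⇒enumerates field-decSetoid complete distinct

  rows-enumerate : ∀ n → Enumerates (row-decSetoid n) (rows n)
  rows-enumerate = allFuns-enumerates field-decSetoid elems-enumerates

  matrices-enumerate : ∀ m n → Enumerates (matrix-decSetoid m n) (allInputs F m n)
  matrices-enumerate m n = allFuns-enumerates (row-decSetoid n) (rows-enumerate n) m

  2≤q : 2 ≤ q
  2≤q = enumerates-distinct⇒2≤length field-decSetoid {elems} elems-enumerates 0≉1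

  detCount : ℕ → Carrier → ℕ
  detCount n y = ∑[ M ∈ allInputs F n n ] 𝟙 (det F n M ≟ y)

  count≡detCount : ∀ n y → count F (detForm F n) y ≡ detCount n y
  count≡detCount n y = length-filter (λ M → det F n M ≟ y) (allInputs F n n)

  𝟙-≈ : ∀ {x x′} y → x ≈ x′ → 𝟙 (x ≟ y) ≡ 𝟙 (x′ ≟ y)
  𝟙-≈ y x≈x′ = 𝟙-⇔ (≈-trans (≈-sym x≈x′)) (≈-trans x≈x′) _ _

  completions : ∀ m → Carrier → Vector Carrier (suc m) → ℕ
  completions m y r = ∑[ R ∈ allInputs F m (suc m) ] 𝟙 (det F (suc m) (r ∷ R) ≟ y)

  detCount-suc : ∀ m y → detCount (suc m) y ≡ ∑[ r ∈ rows (suc m) ] completions m y r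
  detCount-suc m y = ∑-allFuns-suc (DecSetoid.setoid (row-decSetoid (suc m))) m (rows (suc m)) _
                                    (λ M≈N → 𝟙-≈ y (det-cong (suc m) M≈N))

  completions-cong : ∀ m y {r r′ : Vector Carrier (suc m)} → (∀ c → r c ≈ r′ c) →
                     completions m y r ≡ completions m y r′
  completions-cong m y {r} {r′} r≈r′ = ∑-cong (allInputs F m (suc m)) λ R →
    𝟙-≈ y (det-cong (suc m) {r ∷ R} {r′ ∷ R} λ { zero c → r≈r′ c ; (suc i) c → ≈-refl })

  completions-zero : ∀ m y (r : Vector Carrier (suc m)) → (∀ c → r c ≈ 0#) →
                     completions m y r ≡ (q ^ suc m) ^ m * 𝟙 (0# ≟ y)
  completions-zero m y r r≈0 = begin
    completions m y r
      ≡⟨ ∑-cong (allInputs F m (suc m)) (λ R → 𝟙-≈ y (zero-row⇒det≈0 m (r ∷ R) r≈0)) ⟩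
    ∑[ R ∈ allInputs F m (suc m) ] 𝟙 (0# ≟ y)
      ≡⟨ ∑-const (allInputs F m (suc m)) _ ⟩
    length (allInputs F m (suc m)) * 𝟙 (0# ≟ y)
      ≡⟨ cong (_* 𝟙 (0# ≟ y)) (trans (length-allFuns m (rows (suc m)))
                                      (cong (_^ m) (length-allFuns (suc m) elems))) ⟩
    (q ^ suc m) ^ m * 𝟙 (0# ≟ y) ∎
    where open ≡-Reasoning

  e₀ : ∀ {m} → Vector Carrier (suc m)
  e₀ = 1# ∷ λ _ → 0#

  completions-e₀ : ∀ m y → completions m y e₀ ≡ q ^ m * detCount m y
  completions-e₀ m y = trans
    (∑-cong (allInputs F m (suc m)) λ R → 𝟙-≈ y (det-unit-row m (e₀ ∷ R) ≈-refl (λ _ → ≈-refl)))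
    (∑-allFuns-∘ (DecSetoid.setoid (row-decSetoid (suc m))) (DecSetoid.setoid (row-decSetoid m))
                 tail (_∘ suc) (rows (suc m)) (rows m) q fibres m _ (λ M≈N → 𝟙-≈ y (det-cong m M≈N)))
    where
    fibres : ∀ h → h Preserves Pointwise _≈_ ⟶ _≡_ → ∑[ v ∈ rows (suc m) ] h (tail v) ≡ q * ∑ (rows m) h
    fibres h h-cong = trans (∑-allFuns-suc setoid m elems (h ∘ tail) (λ v≈w → h-cong (v≈w ∘ suc)))
                            (∑-const elems _)

  completions-addColumn : ∀ m y {j k : Fin (suc m)} → j ≢ k → ∀ l r →
                          completions m y (addColumn j k l r) ≡ completions m y r
  completions-addColumn m y {j} {k} j≢k l r = trans
    (sym (∑-inverse (matrix-decSetoid m (suc m)) {allInputs F m (suc m)} (matrices-enumerate m (suc m))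
                    (addColumn-inverse j≢k l) (λ R → 𝟙 (det F (suc m) (r′ ∷ R) ≟ y))
                    (λ {R} {S} R≈S → 𝟙-≈ y (det-cong (suc m) {r′ ∷ R} {r′ ∷ S}
                                                      λ { zero c → ≈-refl ; (suc i) c → R≈S i c }))))
    (∑-cong (allInputs F m (suc m)) λ R → 𝟙-≈ y (≈-trans
      (det-cong (suc m) {r′ ∷ (λ i → addColumn j k l (R i))} {λ i → addColumn j k l ((r ∷ R) i)}
                        λ { zero c → ≈-refl ; (suc i) c → ≈-refl })
      (det-addColumn (suc m) (r ∷ R) j≢k l)))
    where r′ = addColumn j k l r

  -- Below a leading 1, the column operations col (suc i) += l · col 0 set any entry to any value.
  completions-unit-head : ∀ m y (r : Vector Carrier (suc (suc m))) → r zero ≈ 1# →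
                          completions (suc m) y r ≡ completions (suc m) y e₀
  completions-unit-head m y r r₀≈1 =
    trans (completions-cong (suc m) y {r} {1# ∷ tail r} λ { zero → r₀≈1 ; (suc c) → ≈-refl })
          (update-invariant⇒constant (suc m) (λ t → completions (suc m) y (1# ∷ t))
            (λ {t} {t′} t≗t′ → completions-cong (suc m) y {1# ∷ t} {1# ∷ t′}
                                 λ { zero → ≈-refl ; (suc c) → ≈-reflexive (t≗t′ c) })
            (λ t i a → trans (completions-cong (suc m) y (λ c → ≈-sym (addColumn-update t i a c)))
                             (completions-addColumn (suc m) y {suc i} {zero} (λ ()) _ (1# ∷ t)))
            (tail r) (λ _ → 0#))

  completions-nonzero-tail : ∀ m y (r : Vector Carrier (suc (suc m))) k → ¬ r (suc k) ≈ 0# →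
                             completions (suc m) y r ≡ completions (suc m) y e₀
  completions-nonzero-tail m y r k rₖ≉0 with addColumn-to-one zero (suc k) r rₖ≉0
  ... | l , r′₀≈1 = trans (sym (completions-addColumn (suc m) y {zero} {suc k} (λ ()) l r))
                          (completions-unit-head m y (addColumn zero (suc k) l r) r′₀≈1)

  completions-nonzero : ∀ m y (r : Vector Carrier (suc (suc m))) → ¬ (∀ c → r c ≈ 0#) →
                        completions (suc m) y r ≡ completions (suc m) y e₀
  completions-nonzero m y r r≉0 with ¬∀⟶∃¬ _ (λ c → r c ≈ 0#) (λ c → r c ≟ 0#) r≉0
  ... | suc k , rₖ≉0 = completions-nonzero-tail m y r k rₖ≉0
  ... | zero  , r₀≉0 with addColumn-to-one (suc zero) zero r r₀≉0
  ...   | l , r′₁≈1 = trans (sym (completions-addColumn (suc m) y {suc zero} {zero} (λ ()) l r))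
                            (completions-nonzero-tail m y (addColumn (suc zero) zero l r) zero
                                                      (λ r′₁≈0 → 0≉1 (≈-trans (≈-sym r′₁≈0) r′₁≈1)))

  detCount-recurrence : ∀ m y → detCount (suc (suc m)) y ≡
    (q ^ suc (suc m)) ^ suc m * 𝟙 (0# ≟ y) + pred (q ^ suc (suc m)) * (q ^ suc m * detCount (suc m) y)
  detCount-recurrence m y = begin
    detCount (suc (suc m)) y
      ≡⟨ detCount-suc (suc m) y ⟩
    ∑[ r ∈ rows (suc (suc m)) ] completions (suc m) y r
      ≡⟨ ∑-constant-except (row-decSetoid (suc (suc m))) {rows (suc (suc m))} (rows-enumerate (suc (suc m)))
                           (completions (suc m) y) (completions-cong (suc m) y) (λ _ → 0#) _
                           (completions-nonzero m y) ⟩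
    completions (suc m) y (λ _ → 0#) + pred (length (rows (suc (suc m)))) * completions (suc m) y e₀
      ≡⟨ cong₂ (λ a b → a + pred b * completions (suc m) y e₀)
               (completions-zero (suc m) y _ (λ _ → ≈-refl)) (length-allFuns (suc (suc m)) elems) ⟩
    (q ^ suc (suc m)) ^ suc m * 𝟙 (0# ≟ y) + pred (q ^ suc (suc m)) * completions (suc m) y e₀
      ≡⟨ cong (λ c → (q ^ suc (suc m)) ^ suc m * 𝟙 (0# ≟ y) + pred (q ^ suc (suc m)) * c)
              (completions-e₀ (suc m) y) ⟩
    (q ^ suc (suc m)) ^ suc m * 𝟙 (0# ≟ y) + pred (q ^ suc (suc m)) * (q ^ suc m * detCount (suc m) y) ∎
    where open ≡-Reasoning

  detCount-1 : ∀ y → detCount 1 y ≡ 1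
  detCount-1 y = trans
    (∑-cong (allInputs F 1 1) λ M → 𝟙-⇔ (λ d≈y → λ { zero zero → ≈-trans (≈-sym (det-1 M)) d≈y })
                                         (λ M≈y → ≈-trans (det-1 M) (M≈y zero zero)) _ (M ≟ᴹ (λ _ _ → y)))
    (matrices-enumerate 1 1 (λ _ _ → y))
    where _≟ᴹ_ = DecSetoid._≟_ (matrix-decSetoid 1 1)

module Gap (q : ℕ) where

  T : ℕ → ℕ
  T n = q ^ (n * n)

  -- gap n = q ^ ((n + 1)²) · bias(det (n + 1)), by the recurrence of detCount
  gap : ℕ → ℕ
  gap zero    = 0
  gap (suc n) = (q ^ suc (suc n)) ^ suc n + pred (q ^ suc (suc n)) * (q ^ suc n * gap n)

  ^-suc-square : ∀ s → (q ^ suc s) ^ s ≡ q ^ s * T s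
  ^-suc-square s = trans (^-*-assoc q (suc s) s) (^-distribˡ-+-* q s (s * s))

  T-suc : ∀ s → T (suc s) ≡ q * (q ^ s * (q ^ s * T s))
  T-suc s = cong (q *_) (begin
    q ^ (s + s * suc s)         ≡⟨ cong (λ e → q ^ (s + e)) (*-suc s s) ⟩
    q ^ (s + (s + s * s))       ≡⟨ ^-distribˡ-+-* q s _ ⟩
    q ^ s * q ^ (s + s * s)     ≡⟨ cong (q ^ s *_) (^-distribˡ-+-* q s (s * s)) ⟩
    q ^ s * (q ^ s * T s)       ∎)
    where open ≡-Reasoning

  module _ (2≤q : 2 ≤ q) where
    instance
      q≢0 : NonZero q
      q≢0 = >-nonZero (≤-trans (s≤s z≤n) 2≤q)

    -- bias(det s) + q^(−s) ≤ 1/q for s = n + 1, multiplied by q^(s+1) · q^(s²)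
    gap-upper : ∀ n → q ^ suc (suc n) * gap n + q * T (suc n) ≤ q ^ suc n * T (suc n)
    gap-upper zero    = ≤-reflexive (base q)
      where
      base : ∀ x → x * (x * 1) * 0 + x * (x * 1) ≡ (x * 1) * (x * 1)
      base = solve-∀
    gap-upper (suc n) = begin
      q * (q * A) * ((q * A) ^ s + P * (A * g)) + q * T (suc s)
        ≡⟨ cong₂ (λ x y → q * (q * A) * (x + P * (A * g)) + q * y) (^-suc-square s) (T-suc s) ⟩
      q * (q * A) * (A * T s + P * (A * g)) + q * (q * (A * (A * T s)))
        ≤⟨ +-monoˡ-≤ _ (*-monoʳ-≤ (q * (q * A))
                         (+-monoʳ-≤ (A * T s) (*-monoˡ-≤ (A * g) (pred[n]≤n {q * A})))) ⟩
      q * (q * A) * (A * T s + q * A * (A * g)) + q * (q * (A * (A * T s)))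
        ≡⟨ expand q A (T s) g ⟩
      q * (q * (A * A)) * (2 * T s + q * A * g)
        ≤⟨ *-monoʳ-≤ (q * (q * (A * A))) (+-monoˡ-≤ (q * A * g) (*-monoˡ-≤ (T s) 2≤q)) ⟩
      q * (q * (A * A)) * (q * T s + q * A * g)
        ≤⟨ *-monoʳ-≤ (q * (q * (A * A)))
                     (≤-trans (≤-reflexive (+-comm (q * T s) (q * A * g))) (gap-upper n)) ⟩
      q * (q * (A * A)) * (A * T s)
        ≡⟨ regroup q A (T s) ⟩
      q * A * (q * (A * (A * T s)))
        ≡⟨ cong (q * A *_) (T-suc s) ⟨
      q ^ suc s * T (suc s) ∎
      where
      open ≤-Reasoning
      s = suc n
      A = q ^ s
      g = gap n
      P = pred (q ^ suc s)
      expand : ∀ x a t g → x * (x * a) * (a * t + x * a * (a * g)) + x * (x * (a * (a * t))) ≡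
                           x * (x * (a * a)) * (2 * t + x * a * g)
      expand = solve-∀
      regroup : ∀ x a t → x * (x * (a * a)) * (a * t) ≡ x * a * (x * (a * (a * t)))
      regroup = solve-∀

    q*gap<T : ∀ n → q * gap n < T (suc n)
    q*gap<T n = *-cancelˡ-< (q ^ suc n) _ _ (begin-strict
      q ^ suc n * (q * gap n)                 ≡⟨ *-assoc (q ^ suc n) q _ ⟨
      q ^ suc n * q * gap n                   ≡⟨ cong (_* gap n) (*-comm (q ^ suc n) q) ⟩
      q ^ suc (suc n) * gap n                 <⟨ m<m+n _ (m^n>0 q (suc (suc n * suc n))) ⟩
      q ^ suc (suc n) * gap n + q * T (suc n) ≤⟨ gap-upper n ⟩
      q ^ suc n * T (suc n)                   ∎)
      where open ≤-Reasoning

    gap≤T : ∀ n → gap n ≤ T (suc n)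
    gap≤T n = ≤-trans (m≤n*m (gap n) q) (<⇒≤ (q*gap<T n))

    gap-lower : ∀ n → T (suc (suc n)) ≤ q * q * gap (suc n)
    gap-lower zero    = ≤-trans (≤-reflexive (base q)) (*-monoʳ-≤ (q * q) (m≤m+n _ _))
      where
      base : ∀ x → x * (x * (x * (x * 1))) ≡ x * x * ((x * (x * 1)) * 1)
      base = solve-∀
    gap-lower (suc n) = begin
      T (suc s)                       ≡⟨ T-suc s ⟩
      q * (A * (A * T s))             ≤⟨ *-monoʳ-≤ q (*-monoʳ-≤ A (*-monoʳ-≤ A (gap-lower n))) ⟩
      q * (A * (A * (q * q * g)))     ≡⟨ regroup q A g ⟩
      q * q * (q * A * (A * g))       ≡⟨ cong (λ x → q * q * (x * (A * g)))
                                              (suc-pred (q * A) {{m^n≢0 q (suc s)}}) ⟨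
      q * q * (A * g + P * (A * g))   ≤⟨ *-monoʳ-≤ (q * q) (+-monoˡ-≤ _ (*-monoʳ-≤ A (gap≤T (suc n)))) ⟩
      q * q * (A * T s + P * (A * g)) ≡⟨ cong (λ x → q * q * (x + P * (A * g))) (^-suc-square s) ⟨
      q * q * gap (suc (suc n))       ∎
      where
      open ≤-Reasoning
      s = suc (suc n)
      A = q ^ s
      g = gap (suc n)
      P = pred (q * A)
      regroup : ∀ x a g → x * (a * (a * (x * x * g))) ≡ x * x * (x * a * (a * g))
      regroup = solve-∀

    T≤gap*q² : ∀ n → T (suc (suc n)) ≤ gap (suc n) * q ^ 2
    T≤gap*q² n = ≤-trans (gap-lower n) (≤-reflexive (trans (*-comm (q * q) (gap (suc n)))
                                                    (cong (λ x → gap (suc n) * (q * x)) (sym (*-identityʳ q)))))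

    gap*q²<q*T : ∀ n → gap (suc n) * q ^ 2 < q * T (suc (suc n))
    gap*q²<q*T n = begin-strict
      gap (suc n) * q ^ 2       ≡⟨ cong (λ x → gap (suc n) * (q * x)) (*-identityʳ q) ⟩
      gap (suc n) * (q * q)     ≡⟨ *-comm (gap (suc n)) (q * q) ⟩
      q * q * gap (suc n)       ≡⟨ *-assoc q q _ ⟩
      q * (q * gap (suc n))     <⟨ *-monoʳ-< q (q*gap<T (suc n)) ⟩
      q * T (suc (suc n))       ∎
      where open ≤-Reasoning

module Fractions where
  open import Data.Integer as ℤ using (ℤ; +_)
  open import Data.Rational as ℚ using (_/_)
  import Data.Rational.Properties as ℚ
  open import Data.Rational.Unnormalised as ℚᵘ using (mkℚᵘ; *≤*; *<*)
  import Data.Rational.Unnormalised.Properties as ℚᵘ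

  *≤*⇒/≤/ : ∀ a b m n .{{_ : NonZero m}} .{{_ : NonZero n}} → a ℤ.* + n ℤ.≤ b ℤ.* + m → a / m ℚ.≤ b / n
  *≤*⇒/≤/ a b (suc m) (suc n) an≤bm = ℚ.toℚᵘ-cancel-≤
    (ℚᵘ.≤-respˡ-≃ (ℚᵘ.≃-sym (ℚ.toℚᵘ-fromℚᵘ (mkℚᵘ a m)))
                  (ℚᵘ.≤-respʳ-≃ (ℚᵘ.≃-sym (ℚ.toℚᵘ-fromℚᵘ (mkℚᵘ b n))) (*≤* an≤bm)))

  *<*⇒/</ : ∀ a b m n .{{_ : NonZero m}} .{{_ : NonZero n}} → a ℤ.* + n ℤ.< b ℤ.* + m → a / m ℚ.< b / n
  *<*⇒/</ a b (suc m) (suc n) an<bm = ℚ.toℚᵘ-cancel-<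
    (ℚᵘ.<-respˡ-≃ (ℚᵘ.≃-sym (ℚ.toℚᵘ-fromℚᵘ (mkℚᵘ a m)))
                  (ℚᵘ.<-respʳ-≃ (ℚᵘ.≃-sym (ℚ.toℚᵘ-fromℚᵘ (mkℚᵘ b n))) (*<* an<bm)))

open Fractions

module _ (F : FiniteField) where
  open FiniteField F using (_≈_; _≟_; 0#) renaming (refl to ≈-refl; sym to ≈-sym)
  open Counting F
  open Gap q using (gap)
  open import Data.Integer as ℤ using (ℤ; +_)
  import Data.Integer.Properties as ℤ
  open import Data.Rational as ℚ using (_/_)
  import Data.Rational.Properties as ℚ

  q^≢0 : ∀ e → NonZero (q ^ e)
  q^≢0 e = m^n≢0 q e {{size≢0 F}}

  infixl 7 _/q^_
  _/q^_ : ℤ → ℕ → ℚ.ℚ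
  i /q^ e = (i / q ^ e) {{q^≢0 e}}

  detCount-gap : ∀ {y} → ¬ y ≈ 0# → ∀ n → detCount (suc n) 0# ≡ detCount (suc n) y + gap n
  detCount-gap {y} y≉0 zero    = trans (detCount-1 0#) (sym (cong (_+ 0) (detCount-1 y)))
  detCount-gap {y} y≉0 (suc n) = begin
    detCount (suc (suc n)) 0#
      ≡⟨ detCount-recurrence n 0# ⟩
    Z * 𝟙 (0# ≟ 0#) + P * (X * detCount (suc n) 0#)
      ≡⟨ cong₂ (λ i d → Z * i + P * (X * d)) (𝟙-yes ≈-refl (0# ≟ 0#)) (detCount-gap y≉0 n) ⟩
    Z * 1 + P * (X * (detCount (suc n) y + gap n))
      ≡⟨ split Z P X (detCount (suc n) y) (gap n) ⟩
    Z * 0 + P * (X * detCount (suc n) y) + (Z + P * (X * gap n))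
      ≡⟨ cong (λ i → Z * i + P * (X * detCount (suc n) y) + gap (suc n)) (𝟙-no (y≉0 ∘ ≈-sym) (0# ≟ y)) ⟨
    Z * 𝟙 (0# ≟ y) + P * (X * detCount (suc n) y) + gap (suc n)
      ≡⟨ cong (_+ gap (suc n)) (detCount-recurrence n y) ⟨
    detCount (suc (suc n)) y + gap (suc n) ∎
    where
    open ≡-Reasoning
    Z = (q ^ suc (suc n)) ^ suc n
    P = pred (q ^ suc (suc n))
    X = q ^ suc n
    split : ∀ z p x b g → z * 1 + p * (x * (b + g)) ≡ z * 0 + p * (x * b) + (z + p * (x * g))
    split = solve-∀

  biasAt-det : ∀ {y} → ¬ y ≈ 0# → ∀ n → biasAt F (detForm F (suc n)) y ≡ + gap n /q^ (suc n * suc n)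
  biasAt-det {y} y≉0 n = ℚ./-cong {{q^≢0 (suc n * suc n)}} {{q^≢0 (suc n * suc n)}} (begin
    + count F (detForm F (suc n)) 0# ℤ.- + count F (detForm F (suc n)) y
      ≡⟨ cong₂ (λ a b → + a ℤ.- + b) (trans (count≡detCount (suc n) 0#) (detCount-gap y≉0 n))
                                     (count≡detCount (suc n) y) ⟩
    + (b + g) ℤ.- + b  ≡⟨ ℤ.[+m]-[+n]≡m⊖n (b + g) b ⟩
    (b + g) ℤ.⊖ b      ≡⟨ ℤ.⊖-≥ (m≤m+n b g) ⟩
    + (b + g ∸ b)      ≡⟨ cong +_ (m+n∸m≡n b g) ⟩
    + g                ∎) refl
    where
    open ≡-Reasoning
    b = detCount (suc n) y
    g = gap n

  ceilArk-/q^ : ∀ k e g → q ^ e ≤ g * q ^ k → g * q ^ k < q * q ^ e → CeilArkIs F (+ g /q^ e) k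
  ceilArk-/q^ k e g lower upper =
    *≤*⇒/≤/ (+ 1) (+ g) (q ^ k) (q ^ e) {{q^≢0 k}} {{q^≢0 e}}
      (≡.subst₂ ℤ._≤_ (sym (ℤ.*-identityˡ _)) (ℤ.pos-* g (q ^ k)) (ℤ.+≤+ lower)) ,
    *<*⇒/</ (+ g) (+ q) (q ^ e) (q ^ k) {{q^≢0 e}} {{q^≢0 k}}
      (≡.subst₂ ℤ._<_ (ℤ.pos-* g (q ^ k)) (ℤ.pos-* q (q ^ e)) (ℤ.+<+ upper))

corollary4p2 : (F : FiniteField) (n : ℕ) → n ≥ 2 →
    (y : FiniteField.Carrier F) → ¬ (FiniteField._≈_ F y (FiniteField.0# F)) →
    CeilArkIs F (biasAt F (detForm F n) y) 2
corollary4p2 F (suc (suc n)) (s≤s (s≤s _)) y y≉0 =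
  ≡.subst (λ b → CeilArkIs F b 2) (sym (biasAt-det F y≉0 (suc n)))
          (ceilArk-/q^ F 2 (suc (suc n) * suc (suc n)) (gap (suc n)) (T≤gap*q² 2≤q n) (gap*q²<q*T 2≤q n))
  where
  open Counting F using (2≤q)
  open Gap (size F) using (gap; T≤gap*q²; gap*q²<q*T)
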